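{- Let $n\ge1$, $k\ge2$. For every $x\in[k]^{n-1}$, $B^*(x(k-1))=0$, and for every $\sigma\in[k]$ with $\sigma<k-1$, $B^*(x\sigma)=A^*(x(\sigma+1))$.
   Context: $[k]=\{0,\dots,k-1\}$; words written by concatenation. The $(k,n)$-prefer-max cycle is $(w_i)_{i=0}^{k^n-1}$ with $w_0=0^{n-1}(k-1)$ and, if $w_i=\sigma x$ ($\sigma\in[k]$, $x\in[k]^{n-1}$), $w_{i+1}=x\tau$ with $\tau$ the maximal letter such that $x\tau\notin\{w_0,\dots,w_i\}$; it is known (Martin) to be well defined and to enumerate each word of $[k]^n$ exactly once. Indices are read modulo $k^n$, so $w_{ -1}=w_{k^n-1}$. Define $B^*,A^*\colon[k]^n\to\{0,1\}$ as follows: $B^*(w_i)=1$ iff $w_i=x\sigma$ and $w_{i-1}=(\sigma+1)x$ for some $x\in[k]^{n-1}$ and $\sigma\in[k]$ with $\sigma<k-1$, and $B^*(w_i)=0$ otherwise; $A^*(w_i)=1$ iff $w_i=x\sigma$ with $\sigma\ne0$ and ($w_{i-1}=0x$ or $B^*(w_i)=1$), and $A^*(w_i)=0$ otherwise. -}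

module Defs where

open import Data.Nat using (ℕ; zero; suc; _^_; _∸_; _<_)
open import Data.Fin using (Fin; zero; suc; toℕ; fromℕ)
open import Data.Fin.Properties using () renaming (_≟_ to _≟F_)
open import Data.Vec using (Vec; []; _∷_; _∷ʳ_; replicate)
open import Data.Vec.Properties using (≡-dec)
open import Data.List using (List; []; _∷_; allFin; reverse)
import Data.List.Membership.DecPropositional as DecMem
open import Data.Product using (Σ; ∃; _×_; _,_)
open import Data.Sum using (_⊎_)
open import Relation.Nullary using (yes; no; ¬_)
open import Relation.Binary.PropositionalEquality using (_≡_)

module PreferMax (j m : ℕ) where

  k n : ℕ
  k = suc j
  n = suc m

  Word : Set
  Word = Vec (Fin k) n

  open DecMem {A = Word} (≡-dec {n = n} (_≟F_ {k})) using (_∈?_)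

  top : Fin k
  top = fromℕ j

  w₀ : Word
  w₀ = replicate m zero ∷ʳ top

  pick : List (Fin k) → Vec (Fin k) m → List Word → Word → Word
  pick [] x hist def = def
  pick (τ ∷ τs) x hist def with (x ∷ʳ τ) ∈? hist
  ... | yes _ = pick τs x hist def
  ... | no  _ = x ∷ʳ τ

  -- next word given the history (most recent word first):
  -- if the current word is σ x, take x τ with τ maximal such that x τ is new.
  -- (The fallback never fires by Martin's theorem.)
  next : List Word → Word
  next [] = w₀
  next ((σ ∷ x) ∷ hs) = pick (reverse (allFin k)) x ((σ ∷ x) ∷ hs) (σ ∷ x)

  history : ℕ → List Word
  history zero = w₀ ∷ []
  history (suc i) = next (history i) ∷ history i

  w : ℕ → Word
  w i with history i
  ... | [] = w₀
  ... | v ∷ _ = v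

  N : ℕ
  N = k ^ n

  prev : ℕ → ℕ
  prev zero = N ∸ 1
  prev (suc i) = i

  -- B* at position i: w_i = x σ and w_{i-1} = (σ+1) x
  -- (τ is σ+1; its existence forces σ < k-1)
  B-at : ℕ → Set
  B-at i = ∃ λ (x : Vec (Fin k) m) → ∃ λ (σ : Fin k) → ∃ λ (τ : Fin k) →
             (w i ≡ x ∷ʳ σ) × (w (prev i) ≡ τ ∷ x) × (toℕ τ ≡ suc (toℕ σ))

  A-at : ℕ → Set
  A-at i = ∃ λ (x : Vec (Fin k) m) → ∃ λ (σ : Fin k) →
             (w i ≡ x ∷ʳ σ) × (¬ σ ≡ zero) × ((w (prev i) ≡ zero ∷ x) ⊎ B-at i)

  -- B*(v) = 1  and  A*(v) = 1, as propositions (v = w_i for some i < k^n)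
  B* : Word → Set
  B* v = ∃ λ i → (i < N) × (w i ≡ v) × B-at i

  A* : Word → Set
  A* v = ∃ λ i → (i < N) × (w i ≡ v) × A-at i

-- Fix x ∈ [k]^(n-1) and let entry x d be the first letter of the word that precedes x d in
-- the cycle; B*(xσ) says entry x σ = σ+1 and A*(xτ) says entry x τ ∈ {0, τ+1}.
--
-- Martin's argument is run as an invariant of the greedy walk: for every node x of the
-- de Bruijn graph, the letters d with x d already used form a top segment of [k], whose size
-- is balanced against the number of visits to x. It shows that the walk only gets stuck after
-- k^n steps, at 0^n, so the cycle enumerates every word once and entry x is a permutation.
-- Prefer-max makes the words x d appear in decreasing order of d, and the balance equations show
-- that raising a nonzero letter of a word already produced gives a word produced even earlier.
-- Together these make entry x increasing away from its zero d₀, and the only such permutation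
-- sends d < d₀ to d+1, d₀ to 0 and fixes d > d₀. So both B*(xσ) and A*(x(σ+1)) say σ < d₀,
-- while B*(x(k-1)) is impossible since k-1 has no successor letter.

module Submission where

open import Defs
open import Data.Nat using (ℕ; suc)
open import Data.Fin using (Fin; toℕ)
open import Data.Vec using (Vec; _∷ʳ_)
open import Data.Product using (_×_)
open import Relation.Binary.PropositionalEquality using (_≡_)
open import Relation.Nullary using (¬_)
open import Function.Bundles using (_⇔_)

open import Level using (0ℓ)
open import Data.Nat as ℕ using (zero; _+_; _∸_; z≤n; s≤s)
import Data.Nat.Properties as ℕ
open import Data.Nat.Induction using (<-rec)
open import Data.Fin as F using (zero; suc; fromℕ<; punchIn; punchOut; opposite)
open import Data.Fin.Properties as F
  using (toℕ-injective; toℕ<n; toℕ-fromℕ<; opposite-prop; opposite-involutive; punchIn-mono-≤; punchIn-injective;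
         punchInᵢ≢i; punchIn-punchOut; punchOut-mono-≤; punchOut-injective; ≤∧≢⇒<; <⇒≢)
open import Data.Vec using ([]; _∷_; replicate; head; tail; lookup)
open import Data.Vec.Properties using (≡-dec; ∷-injectiveˡ; ∷-injectiveʳ; ∷ʳ-injective; ∷ʳ-injectiveˡ; ∷ʳ-injectiveʳ)
open import Data.Vec.Recursive using (Fin[m^n]↔Fin[m]^n)
open import Data.Vec.Recursive.Properties using (↔Vec)
open import Data.List using (List; []; _∷_; reverse; allFin)
open import Data.List.Base using (reverseAcc)
open import Data.List.Relation.Unary.All as All using (All; []; _∷_)
open import Data.List.Relation.Unary.AllPairs using (AllPairs; []; _∷_)
import Data.List.Relation.Unary.AllPairs.Properties as AllPairs
open import Data.List.Relation.Unary.Any using (here; there)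
import Data.List.Relation.Unary.Any.Properties as Any
open import Data.List.Membership.Propositional using (_∈_; _∉_)
open import Data.List.Membership.Propositional.Properties using (∈-allFin)
import Data.List.Membership.DecPropositional as DecMembership
open import Data.Product using (∃; _,_; proj₁; proj₂)
open import Data.Sum as Sum using (_⊎_; inj₁; inj₂; [_,_])
open import Data.Sum.Function.Propositional using (_⊎-cong_)
open import Data.Empty using (⊥-elim)
open import Function using (_∘_; id; flip)
open import Function.Bundles using (mk⇔; Equivalence; _↔_; Injection)
open import Function.Definitions using (Injective)
open import Function.Properties.Inverse using (↔-trans; ↔-sym; ↔⇒↣)
open import Function.Related.Propositional using (module EquationalReasoning; SK-sym)
open import Relation.Binary.Core using (Rel; _Preserves_⟶_)
open import Relation.Binary.PropositionalEquality
  using (_≢_; refl; sym; trans; cong; cong₂; subst; subst₂; module ≡-Reasoning)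
open import Relation.Nullary using (Dec; yes; no; contradiction)
open import Relation.Unary using (Pred; Decidable)

-- Strictly increasing maps on Fin

opposite-<-reverse : ∀ {n} {i j : Fin n} → i F.< j → opposite j F.< opposite i
opposite-<-reverse {n} {i} {j} i<j =
  subst₂ ℕ._<_ (sym (opposite-prop j)) (sym (opposite-prop i)) (ℕ.∸-monoʳ-< (s≤s i<j) (toℕ<n j))

module _ {n : ℕ} (f : Fin n → Fin n) (f-mono : f Preserves F._<_ ⟶ F._<_) where

  strictMono⇒≤ : ∀ i → i F.≤ f i
  strictMono⇒≤ i = go (toℕ i) i refl
    where
    go : ∀ a i → toℕ i ≡ a → a ℕ.≤ toℕ (f i)
    go zero    i _     = z≤n
    go (suc a) i i≡1+a = ℕ.≤-<-trans (go a i′ (toℕ-fromℕ< a<n)) (f-mono i′<i)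
      where
      a<n : a ℕ.< n
      a<n = ℕ.<-trans (ℕ.n<1+n a) (subst (ℕ._< n) i≡1+a (toℕ<n i))
      i′ : Fin n
      i′ = fromℕ< a<n
      i′<i : i′ F.< i
      i′<i = subst₂ ℕ._<_ (sym (toℕ-fromℕ< a<n)) (sym i≡1+a) ℕ.≤-refl

strictMono⇒≗id : ∀ {n} (f : Fin n → Fin n) → f Preserves F._<_ ⟶ F._<_ → ∀ i → f i ≡ i
strictMono⇒≗id {n} f f-mono i = toℕ-injective (ℕ.≤-antisym fi≤i (strictMono⇒≤ f f-mono i))
  where
  g : Fin n → Fin n
  g = opposite ∘ f ∘ opposite
  g-mono : g Preserves F._<_ ⟶ F._<_
  g-mono = opposite-<-reverse ∘ f-mono ∘ opposite-<-reverse
  opp-i≤opp-fi : opposite i F.≤ opposite (f i)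
  opp-i≤opp-fi = subst (λ x → opposite i F.≤ opposite (f x)) (opposite-involutive i) (strictMono⇒≤ g g-mono (opposite i))
  fi≤i : f i F.≤ i
  fi≤i = ℕ.s≤s⁻¹ (ℕ.∸-cancelʳ-≤ (toℕ<n (f i)) (subst₂ ℕ._≤_ (opposite-prop i) (opposite-prop (f i)) opp-i≤opp-fi))

toℕ-punchIn≡⇔< : ∀ {n} (i : Fin (suc n)) (j : Fin n) → toℕ (punchIn i j) ≡ toℕ j ⇔ punchIn i j F.< i
toℕ-punchIn≡⇔< zero    j       = mk⇔ (⊥-elim ∘ ℕ.1+n≢n) (λ ())
toℕ-punchIn≡⇔< (suc i) zero    = mk⇔ (λ _ → s≤s z≤n) (λ _ → refl)
toℕ-punchIn≡⇔< (suc i) (suc j) = mk⇔ (s≤s ∘ to ∘ ℕ.suc-injective) (cong suc ∘ from ∘ ℕ.s≤s⁻¹)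
  where open Equivalence (toℕ-punchIn≡⇔< i j)

module IncreasingOffZero {n} (p : Fin (suc n) → Fin (suc n)) (p-injective : Injective _≡_ _≡_ p)
         (p-mono : ∀ {d d′} → d F.< d′ → p d′ ≢ zero → p d F.< p d′)
         {d₀} (p[d₀]≡0 : p d₀ ≡ zero) where

  private
    p[punchIn]≢0 : ∀ e → zero ≢ p (punchIn d₀ e)
    p[punchIn]≢0 e eq = punchInᵢ≢i d₀ e (p-injective (trans (sym eq) (sym p[d₀]≡0)))

    q : Fin n → Fin n
    q e = punchOut (p[punchIn]≢0 e)

    punchIn-mono-< : ∀ {e e′} → e F.< e′ → punchIn d₀ e F.< punchIn d₀ e′
    punchIn-mono-< e<e′ = ≤∧≢⇒< (punchIn-mono-≤ d₀ _ _ (ℕ.<⇒≤ e<e′)) (<⇒≢ e<e′ ∘ punchIn-injective d₀ _ _)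

    q-mono : q Preserves F._<_ ⟶ F._<_
    q-mono {e} {e′} e<e′ =
      ≤∧≢⇒< (punchOut-mono-≤ ≢e ≢e′ (ℕ.<⇒≤ pe<pe′)) (<⇒≢ pe<pe′ ∘ punchOut-injective ≢e ≢e′)
      where
      ≢e : zero ≢ p (punchIn d₀ e)
      ≢e = p[punchIn]≢0 e
      ≢e′ : zero ≢ p (punchIn d₀ e′)
      ≢e′ = p[punchIn]≢0 e′
      pe<pe′ : p (punchIn d₀ e) F.< p (punchIn d₀ e′)
      pe<pe′ = p-mono (punchIn-mono-< e<e′) (≢e′ ∘ sym)

  -- q is p with d₀ removed from its domain and 0 from its range; being strictly increasing,
  -- it is the identity.
  p[punchIn]≡suc : ∀ e → p (punchIn d₀ e) ≡ suc e
  p[punchIn]≡suc e = trans (sym (punchIn-punchOut (p[punchIn]≢0 e))) (cong suc (strictMono⇒≗id q q-mono e))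

  p[d]≡0⇔d≡d₀ : ∀ {d} → p d ≡ zero ⇔ d ≡ d₀
  p[d]≡0⇔d≡d₀ = mk⇔ (λ eq → p-injective (trans eq (sym p[d₀]≡0))) (λ { refl → p[d₀]≡0 })

  p[d]≡1+d⇔d<d₀ : ∀ d → toℕ (p d) ≡ suc (toℕ d) ⇔ d F.< d₀
  p[d]≡1+d⇔d<d₀ d with d F.≟ d₀
  ... | yes refl = mk⇔ (λ eq → contradiction (trans (sym (cong toℕ p[d₀]≡0)) eq) λ ()) (contradiction refl ∘ ℕ.<⇒≢)
  ... | no d≢d₀  = subst (λ d → toℕ (p d) ≡ suc (toℕ d) ⇔ d F.< d₀) (punchIn-punchOut (d≢d₀ ∘ sym)) (at-punchIn _)
    where
    at-punchIn : ∀ e → toℕ (p (punchIn d₀ e)) ≡ suc (toℕ (punchIn d₀ e)) ⇔ punchIn d₀ e F.< d₀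
    at-punchIn e rewrite p[punchIn]≡suc e = mk⇔ (to ∘ sym ∘ ℕ.suc-injective) (cong suc ∘ sym ∘ from)
      where open Equivalence (toℕ-punchIn≡⇔< d₀ e)

  p[σ]≡1+σ⇔p[τ]≡0⊎1+τ : ∀ {σ τ} → toℕ τ ≡ suc (toℕ σ) →
                         toℕ (p σ) ≡ suc (toℕ σ) ⇔ (p τ ≡ zero ⊎ toℕ (p τ) ≡ suc (toℕ τ))
  p[σ]≡1+σ⇔p[τ]≡0⊎1+τ {σ} {τ} τ≡1+σ = begin
    toℕ (p σ) ≡ suc (toℕ σ)                  ∼⟨ p[d]≡1+d⇔d<d₀ σ ⟩
    σ F.< d₀                                  ∼⟨ mk⇔ (subst (ℕ._≤ toℕ d₀) (sym τ≡1+σ)) (subst (ℕ._≤ toℕ d₀) τ≡1+σ) ⟩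
    τ F.≤ d₀                                  ∼⟨ mk⇔ (Sum.map toℕ-injective id ∘ Sum.swap ∘ ℕ.m≤n⇒m<n∨m≡n)
                                                     [ ℕ.≤-reflexive ∘ cong toℕ , ℕ.<⇒≤ ] ⟩
    (τ ≡ d₀ ⊎ τ F.< d₀)                       ∼⟨ SK-sym (p[d]≡0⇔d≡d₀ ⊎-cong p[d]≡1+d⇔d<d₀ τ) ⟩
    (p τ ≡ zero ⊎ toℕ (p τ) ≡ suc (toℕ τ))   ∎
    where open EquationalReasoning

-- Counting

[_] : ∀ {A : Set} → Dec A → ℕ
[ yes _ ] = 1
[ no _ ]  = 0

[yes] : ∀ {A : Set} (a? : Dec A) → A → [ a? ] ≡ 1
[yes] (yes _) _ = refl
[yes] (no ¬a) a = contradiction a ¬a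

[no] : ∀ {A : Set} (a? : Dec A) → ¬ A → [ a? ] ≡ 0
[no] (yes a) ¬a = contradiction a ¬a
[no] (no _)  _  = refl

count : ∀ {n} {P : Pred (Fin n) 0ℓ} → Decidable P → ℕ
count {zero}  P? = 0
count {suc n} P? = [ P? zero ] + count (P? ∘ suc)

count-mono : ∀ {n} {P Q : Pred (Fin n) 0ℓ} (P? : Decidable P) (Q? : Decidable Q) →
             (∀ {i} → P i → Q i) → count P? ℕ.≤ count Q?
count-mono {zero}  P? Q? P⇒Q = z≤n
count-mono {suc n} P? Q? P⇒Q with P? zero | Q? zero
... | yes _  | yes _  = s≤s (count-mono (P? ∘ suc) (Q? ∘ suc) P⇒Q)
... | yes P0 | no ¬Q0 = contradiction (P⇒Q P0) ¬Q0
... | no _   | yes _  = ℕ.m≤n⇒m≤1+n (count-mono (P? ∘ suc) (Q? ∘ suc) P⇒Q)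
... | no _   | no _   = count-mono (P? ∘ suc) (Q? ∘ suc) P⇒Q

count-cong : ∀ {n} {P Q : Pred (Fin n) 0ℓ} (P? : Decidable P) (Q? : Decidable Q) →
             (∀ {i} → P i ⇔ Q i) → count P? ≡ count Q?
count-cong P? Q? P⇔Q =
  ℕ.≤-antisym (count-mono P? Q? (Equivalence.to P⇔Q)) (count-mono Q? P? (Equivalence.from P⇔Q))

count≤n : ∀ {n} {P : Pred (Fin n) 0ℓ} (P? : Decidable P) → count P? ℕ.≤ n
count≤n {zero}  P? = z≤n
count≤n {suc n} P? with P? zero
... | yes _ = s≤s (count≤n (P? ∘ suc))
... | no _  = ℕ.m≤n⇒m≤1+n (count≤n (P? ∘ suc))

count<n : ∀ {n} {P : Pred (Fin n) 0ℓ} (P? : Decidable P) {i} → ¬ P i → count P? ℕ.< n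
count<n {suc n} P? {i} ¬Pi with P? zero | i
... | yes P0 | zero  = contradiction P0 ¬Pi
... | yes _  | suc i = s≤s (count<n (P? ∘ suc) ¬Pi)
... | no _   | _     = s≤s (count≤n (P? ∘ suc))

count≡0 : ∀ {n} {P : Pred (Fin n) 0ℓ} (P? : Decidable P) → (∀ {i} → ¬ P i) → count P? ≡ 0
count≡0 {zero}  P? ¬P = refl
count≡0 {suc n} P? ¬P with P? zero
... | yes P0 = contradiction P0 ¬P
... | no _   = count≡0 (P? ∘ suc) ¬P

private
  insert-zero : ∀ {n} {P Q : Pred (Fin (suc n)) 0ℓ} → (∀ {i} → Q i ⇔ (i ≡ zero ⊎ P i)) →
                ∀ {i} → Q (suc i) ⇔ P (suc i)
  insert-zero {P = P} Q⇔ = mk⇔ (drop-zero ∘ to) (from ∘ inj₂)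
    where
    open Equivalence Q⇔
    drop-zero : ∀ {i} → suc i ≡ zero ⊎ P (suc i) → P (suc i)
    drop-zero (inj₁ ())
    drop-zero (inj₂ P1+i) = P1+i

  insert-suc : ∀ {n} {P Q : Pred (Fin (suc n)) 0ℓ} {i₀} → (∀ {i} → Q i ⇔ (i ≡ suc i₀ ⊎ P i)) →
               ∀ {i} → Q (suc i) ⇔ (i ≡ i₀ ⊎ P (suc i))
  insert-suc Q⇔ = mk⇔ (Sum.map₁ F.suc-injective ∘ to) (from ∘ Sum.map₁ (cong suc))
    where open Equivalence Q⇔

count-insert : ∀ {n} {P Q : Pred (Fin n) 0ℓ} (P? : Decidable P) (Q? : Decidable Q) {i₀} →
               ¬ P i₀ → (∀ {i} → Q i ⇔ (i ≡ i₀ ⊎ P i)) → count Q? ≡ suc (count P?)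
count-insert {suc n} P? Q? {i₀} ¬Pi₀ Q⇔ with P? zero | Q? zero | i₀
... | yes P0 | _      | zero  = contradiction P0 ¬Pi₀
... | _      | no ¬Q0 | zero  = contradiction (Equivalence.from Q⇔ (inj₁ refl)) ¬Q0
... | no _   | yes _  | zero  = cong suc (count-cong (Q? ∘ suc) (P? ∘ suc) (insert-zero Q⇔))
... | yes _  | yes _  | suc _ = cong suc (count-insert (P? ∘ suc) (Q? ∘ suc) ¬Pi₀ (insert-suc Q⇔))
... | yes P0 | no ¬Q0 | suc _ = contradiction (Equivalence.from Q⇔ (inj₂ P0)) ¬Q0
... | no _   | no _   | suc _ = count-insert (P? ∘ suc) (Q? ∘ suc) ¬Pi₀ (insert-suc Q⇔)
... | no ¬P0 | yes Q0 | suc _ with Equivalence.to Q⇔ Q0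
...   | inj₂ P0 = contradiction P0 ¬P0

rebalance : ∀ a c I Z → a ≡ I + Z → a + c ≡ (c + I) + Z
rebalance a c I Z refl = trans (ℕ.+-comm (I + Z) c) (sym (ℕ.+-assoc c I Z))

AllPairs-reverse⁺ : ∀ {A : Set} {R : Rel A 0ℓ} {xs} → AllPairs R xs → AllPairs (flip R) (reverse xs)
AllPairs-reverse⁺ {R = R} = go [] [] []
  where
  go : ∀ acc {xs} → AllPairs (flip R) acc → All (λ a → All (R a) xs) acc →
       AllPairs R xs → AllPairs (flip R) (reverseAcc acc xs)
  go acc acc↓ acc<xs []         = acc↓
  go acc acc↓ acc<xs (x< ∷ xs↑) =
    go (_ ∷ acc) (All.map All.head acc<xs ∷ acc↓) (x< ∷ All.map All.tail acc<xs) xs↑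

Vec↔Fin^ : ∀ q l → Vec (Fin q) l ↔ Fin (q ℕ.^ l)
Vec↔Fin^ q l = ↔-trans (↔-sym (↔Vec l)) (↔-sym (Fin[m^n]↔Fin[m]^n q l))

module _ {A : Set} where

  replicate-∷ʳ : ∀ l (z : A) → replicate l z ∷ʳ z ≡ z ∷ replicate l z
  replicate-∷ʳ zero    z = refl
  replicate-∷ʳ (suc l) z = cong (z ∷_) (replicate-∷ʳ l z)

  lookup-∷ʳ : ∀ {l} (v : Vec A l) z (p : Fin (suc l)) →
              (toℕ p ≡ l × lookup (v ∷ʳ z) p ≡ z) ⊎ ∃ λ p′ → toℕ p ≡ toℕ p′ × lookup (v ∷ʳ z) p ≡ lookup v p′
  lookup-∷ʳ []      z zero    = inj₁ (refl , refl)
  lookup-∷ʳ (a ∷ v) z zero    = inj₂ (zero , refl , refl)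
  lookup-∷ʳ (a ∷ v) z (suc p) with lookup-∷ʳ v z p
  ... | inj₁ (p≡l , eq)        = inj₁ (cong suc p≡l , eq)
  ... | inj₂ (p′ , p≡p′ , eq) = inj₂ (suc p′ , cong suc p≡p′ , eq)

  ConstantFrom : ∀ {l} → ℕ → A → Vec A l → Set
  ConstantFrom c z v = ∀ p → c ℕ.≤ toℕ p → lookup v p ≡ z

  ConstantFrom-length : ∀ {l} z (v : Vec A l) → ConstantFrom l z v
  ConstantFrom-length z v p l≤p = contradiction l≤p (ℕ.<⇒≱ (toℕ<n p))

  ConstantFrom-zero : ∀ {l z} (v : Vec A l) → ConstantFrom 0 z v → v ≡ replicate l z
  ConstantFrom-zero []      _     = refl
  ConstantFrom-zero (a ∷ v) const = cong₂ _∷_ (const zero z≤n) (ConstantFrom-zero v (λ p _ → const (suc p) z≤n))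

  ConstantFrom-shift : ∀ {l c z} a (v : Vec A l) → ConstantFrom (suc c) z (a ∷ v) → ConstantFrom c z (v ∷ʳ z)
  ConstantFrom-shift {c = c} {z} a v const p c≤p with lookup-∷ʳ v z p
  ... | inj₁ (_ , eq)         = eq
  ... | inj₂ (p′ , p≡p′ , eq) = trans eq (const (suc p′) (s≤s (subst (c ℕ.≤_) p≡p′ c≤p)))

module _ {q : ℕ} where

  data Raised : ∀ {l} → Vec (Fin (suc q)) l → Vec (Fin (suc q)) l → Set where
    here  : ∀ {l a b} {v : Vec (Fin (suc q)) l} → 0 ℕ.< toℕ b → b F.< a → Raised (b ∷ v) (a ∷ v)
    there : ∀ {l c} {v v′ : Vec (Fin (suc q)) l} → Raised v v′ → Raised (c ∷ v) (c ∷ v′)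

  Raised-∷ʳ : ∀ {l} (x : Vec (Fin (suc q)) l) c {v} → Raised (x ∷ʳ c) v →
              (∃ λ x′ → v ≡ x′ ∷ʳ c × Raised x x′) ⊎ (∃ λ c′ → v ≡ x ∷ʳ c′ × c F.< c′)
  Raised-∷ʳ []      c (here {a = a} _ c<a)   = inj₂ (a , refl , c<a)
  Raised-∷ʳ (b ∷ x) c (here {a = a} 0<b b<a) = inj₁ (a ∷ x , refl , here 0<b b<a)
  Raised-∷ʳ (b ∷ x) c (there raised) with Raised-∷ʳ x c raised
  ... | inj₁ (x′ , refl , raised′) = inj₁ (b ∷ x′ , refl , there raised′)
  ... | inj₂ (c′ , refl , c<c′)    = inj₂ (c′ , refl , c<c′)

  Raised⇒≢replicate : ∀ {l} {v v′ : Vec (Fin (suc q)) l} → Raised v v′ → v ≢ replicate l zero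
  Raised⇒≢replicate (here 0<b _)   refl = ℕ.<-irrefl refl 0<b
  Raised⇒≢replicate (there raised) eq   = Raised⇒≢replicate raised (cong tail eq)

  Raised⇒≢ : ∀ {l} {v v′ : Vec (Fin (suc q)) l} → Raised v v′ → v ≢ v′
  Raised⇒≢ (here _ b<a)   refl = ℕ.<-irrefl refl b<a
  Raised⇒≢ (there raised) eq   = Raised⇒≢ raised (cong tail eq)

-- The prefer-max walk

-- As in the theorem, the alphabet has k = j + 2 ≥ 2 letters.
module PreferMaxCycle (j m : ℕ) where

  open PreferMax (suc j) m public
  open DecMembership {A = Word} (≡-dec F._≟_) using (_∈?_)

  -- Words are the edges of the de Bruijn graph: ρ ∷ y enters the node y and y ∷ʳ d leaves it.
  Node : Set
  Node = Vec (Fin k) m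

  _≟_ : (x y : Node) → Dec (x ≡ y)
  _≟_ = ≡-dec F._≟_

  zeros : Node
  zeros = replicate m zero

  past : ℕ → List Word
  past zero    = []
  past (suc t) = history t

  history≡ : ∀ t → history t ≡ w t ∷ past t
  history≡ zero    = refl
  history≡ (suc t) = refl

  Before : ℕ → Word → Set
  Before t v = ∃ λ s → s ℕ.< t × w s ≡ v

  ∈history⁻ : ∀ {v} t → v ∈ history t → Before (suc t) v
  ∈history⁻ zero    (here refl) = 0 , s≤s z≤n , refl
  ∈history⁻ (suc t) (here refl) = suc t , ℕ.≤-refl , refl
  ∈history⁻ (suc t) (there v∈) with ∈history⁻ t v∈
  ... | s , s<1+t , ws≡v = s , ℕ.m≤n⇒m≤1+n s<1+t , ws≡v

  w∈history : ∀ {s t} → s ℕ.≤ t → w s ∈ history t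
  w∈history {zero}  {zero}  z≤n = here refl
  w∈history {s}     {suc t} s≤1+t with ℕ.m≤n⇒m<n∨m≡n s≤1+t
  ... | inj₁ (s≤s s≤t) = there (w∈history s≤t)
  ... | inj₂ refl      = here refl

  descending : List (Fin k)
  descending = reverse (allFin k)

  w-suc≡pick : ∀ t → w (suc t) ≡ pick descending (tail (w t)) (history t) (w t)
  w-suc≡pick t = begin
    next (history t)                                    ≡⟨ cong next (history≡ t) ⟩
    next (w t ∷ past t)                                 ≡⟨ next-∷ (w t) (past t) ⟩
    pick descending (tail (w t)) (w t ∷ past t) (w t)   ≡⟨ cong (λ H → pick descending (tail (w t)) H (w t)) (history≡ t) ⟨
    pick descending (tail (w t)) (history t) (w t)      ∎
    where
    open ≡-Reasoning
    next-∷ : ∀ v hs → next (v ∷ hs) ≡ pick descending (tail v) (v ∷ hs) v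
    next-∷ (_ ∷ _) _ = refl

  pick-greedy : ∀ {τs} → AllPairs (flip F._<_) τs → ∀ x H def →
                All (λ τ → x ∷ʳ τ ∈ H) τs ⊎
                ∃ λ τ → pick τs x H def ≡ x ∷ʳ τ × x ∷ʳ τ ∉ H ×
                        (∀ {τ′} → τ′ ∈ τs → τ F.< τ′ → x ∷ʳ τ′ ∈ H)
  pick-greedy {[]}     []           x H def = inj₁ []
  pick-greedy {τ ∷ τs} (τ>τs ∷ τs↓) x H def with (x ∷ʳ τ) ∈? H
  ... | no xτ∉H = inj₂ (τ , refl , xτ∉H , larger)
    where
    larger : ∀ {τ′} → τ′ ∈ τ ∷ τs → τ F.< τ′ → x ∷ʳ τ′ ∈ H
    larger (here refl) τ<τ  = contradiction τ<τ (ℕ.<-irrefl refl)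
    larger (there τ′∈) τ<τ′ = contradiction τ<τ′ (ℕ.<-asym (All.lookup τ>τs τ′∈))
  ... | yes xτ∈H with pick-greedy τs↓ x H def
  ...   | inj₁ all-used = inj₁ (xτ∈H ∷ all-used)
  ...   | inj₂ (τ₁ , pick≡ , fresh , larger) = inj₂ (τ₁ , pick≡ , fresh , larger′)
    where
    larger′ : ∀ {τ′} → τ′ ∈ τ ∷ τs → τ₁ F.< τ′ → x ∷ʳ τ′ ∈ H
    larger′ (here refl) _     = xτ∈H
    larger′ (there τ′∈) τ₁<τ′ = larger τ′∈ τ₁<τ′

  Stuck : ℕ → Set
  Stuck t = ∀ τ → tail (w t) ∷ʳ τ ∈ history t

  record GreedyStep (t : ℕ) : Set where
    field
      letter      : Fin k
      w-suc≡      : w (suc t) ≡ tail (w t) ∷ʳ letter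
      fresh       : tail (w t) ∷ʳ letter ∉ history t
      larger-used : ∀ {τ} → letter F.< τ → tail (w t) ∷ʳ τ ∈ history t

  stuck-or-greedy : ∀ t → Stuck t ⊎ GreedyStep t
  stuck-or-greedy t with pick-greedy (AllPairs-reverse⁺ (AllPairs.tabulate⁺-< id)) (tail (w t)) (history t) (w t)
  ... | inj₁ all-used = inj₁ (λ τ → All.lookup all-used (Any.reverse⁺ (∈-allFin τ)))
  ... | inj₂ (τ , pick≡ , fresh , larger) = inj₂ (record
    { letter      = τ
    ; w-suc≡      = trans (w-suc≡pick t) pick≡
    ; fresh       = fresh
    ; larger-used = larger (Any.reverse⁺ (∈-allFin _))
    })

  indeg : List Word → Node → ℕ
  indeg H y = count (λ ρ → (ρ ∷ y) ∈? H)

  indeg-[] : ∀ y → indeg [] y ≡ 0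
  indeg-[] y = count≡0 (λ ρ → (ρ ∷ y) ∈? []) (λ ())

  indeg-∷ : ∀ {v H} y → v ∉ H → indeg (v ∷ H) y ≡ [ tail v ≟ y ] + indeg H y
  indeg-∷ {σ ∷ z} {H} y v∉H with z ≟ y
  ... | yes refl = count-insert (λ ρ → (ρ ∷ z) ∈? H) (λ ρ → (ρ ∷ z) ∈? ((σ ∷ z) ∷ H)) v∉H (mk⇔ to from)
    where
    to : ∀ {ρ} → ρ ∷ z ∈ (σ ∷ z) ∷ H → ρ ≡ σ ⊎ ρ ∷ z ∈ H
    to (here eq) = inj₁ (∷-injectiveˡ eq)
    to (there ∈) = inj₂ ∈
    from : ∀ {ρ} → ρ ≡ σ ⊎ ρ ∷ z ∈ H → ρ ∷ z ∈ (σ ∷ z) ∷ H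
    from (inj₁ refl) = here refl
    from (inj₂ ∈)    = there ∈
  ... | no z≢y = count-cong (λ ρ → (ρ ∷ y) ∈? ((σ ∷ z) ∷ H)) (λ ρ → (ρ ∷ y) ∈? H) (mk⇔ to there)
    where
    to : ∀ {ρ} → ρ ∷ y ∈ (σ ∷ z) ∷ H → ρ ∷ y ∈ H
    to (here eq) = contradiction (sym (∷-injectiveʳ eq)) z≢y
    to (there ∈) = ∈

  -- Every visit to x but the current one was followed by a departure from x, and w₀ departs
  -- from zeros without a visit.
  record Balanced (t : ℕ) (x : Node) : Set where
    field
      outdeg    : ℕ
      out-edge⇔ : ∀ d → x ∷ʳ d ∈ history t ⇔ k ℕ.≤ toℕ d + outdeg
      balance   : outdeg + [ tail (w t) ≟ x ] ≡ indeg (history t) x + [ x ≟ zeros ]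

  module _ {t x} (b : Balanced t x) where

    open Balanced b

    balance-current : tail (w t) ≡ x → suc outdeg ≡ indeg (history t) x + [ x ≟ zeros ]
    balance-current refl = trans (ℕ.+-comm 1 outdeg) (trans (cong (outdeg +_) (sym ([yes] (x ≟ x) refl))) balance)

    balance-other : tail (w t) ≢ x → outdeg ≡ indeg (history t) x + [ x ≟ zeros ]
    balance-other X≢x = trans (sym (ℕ.+-identityʳ outdeg)) (trans (cong (outdeg +_) (sym ([no] (_ ≟ x) X≢x))) balance)

  Distinct : ℕ → Set
  Distinct t = ∀ {a b} → a ℕ.≤ t → b ℕ.≤ t → w a ≡ w b → a ≡ b

  record Invariant (t : ℕ) : Set where
    field
      balanced : ∀ x → Balanced t x
      distinct : Distinct t

  toℕ-top : toℕ top ≡ suc j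
  toℕ-top = F.toℕ-fromℕ (suc j)

  ≡top⇔ : ∀ {d} → d ≡ top ⇔ k ℕ.≤ toℕ d + 1
  ≡top⇔ {d} = mk⇔ to from
    where
    to : d ≡ top → k ℕ.≤ toℕ d + 1
    to refl = ℕ.≤-reflexive (trans (cong suc (sym toℕ-top)) (ℕ.+-comm 1 (toℕ top)))
    from : k ℕ.≤ toℕ d + 1 → d ≡ top
    from k≤d+1 = toℕ-injective (trans (ℕ.≤-antisym (ℕ.≤-pred (toℕ<n d)) (ℕ.≤-pred k≤1+d)) (sym toℕ-top))
      where
      k≤1+d : k ℕ.≤ suc (toℕ d)
      k≤1+d = subst (k ℕ.≤_) (ℕ.+-comm (toℕ d) 1) k≤d+1

  balanced-zero : ∀ x → Balanced 0 x
  balanced-zero x = record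
    { outdeg    = [ x ≟ zeros ]
    ; out-edge⇔ = out-edge⇔
    ; balance   = trans (ℕ.+-comm [ x ≟ zeros ] _) (cong (_+ [ x ≟ zeros ]) (sym indeg₀))
    }
    where
    indeg₀ : indeg (history 0) x ≡ [ tail w₀ ≟ x ]
    indeg₀ = trans (indeg-∷ {w₀} {[]} x λ ()) (trans (cong ([ tail w₀ ≟ x ] +_) (indeg-[] x)) (ℕ.+-identityʳ _))
    out-edge⇔ : ∀ d → x ∷ʳ d ∈ history 0 ⇔ k ℕ.≤ toℕ d + [ x ≟ zeros ]
    out-edge⇔ d with x ≟ zeros
    ... | yes refl   = mk⇔ (Equivalence.to ≡top⇔ ∘ λ { (here eq) → ∷ʳ-injectiveʳ _ _ eq ; (there ()) })
                           (λ k≤d+1 → here (cong (zeros ∷ʳ_) (Equivalence.from ≡top⇔ k≤d+1)))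
    ... | no x≢zeros = mk⇔ (λ { (here eq) → contradiction (∷ʳ-injectiveˡ _ _ eq) x≢zeros ; (there ()) })
                           (λ k≤d+0 → contradiction (subst (k ℕ.≤_) (ℕ.+-identityʳ _) k≤d+0) (ℕ.<⇒≱ (toℕ<n d)))

  invariant-zero : Invariant 0
  invariant-zero = record { balanced = balanced-zero ; distinct = λ { z≤n z≤n _ → refl } }

  module Step {t} (inv : Invariant t) (g : GreedyStep t) where

    open Invariant inv
    open GreedyStep g

    X : Node
    X = tail (w t)

    open Balanced (balanced X) using (outdeg; out-edge⇔)

    new∉ : w (suc t) ∉ history t
    new∉ = subst (_∉ history t) (sym w-suc≡) fresh

    greedy-outdeg : suc (toℕ letter + outdeg) ≡ k
    greedy-outdeg = ℕ.≤-antisym (ℕ.≰⇒> (fresh ∘ Equivalence.from (out-edge⇔ letter))) k≤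
      where
      k≤ : k ℕ.≤ suc (toℕ letter + outdeg)
      k≤ with suc (toℕ letter) ℕ.<? k
      ... | yes 1+letter<k = subst (λ a → k ℕ.≤ a + outdeg) (toℕ-fromℕ< 1+letter<k)
                               (Equivalence.to (out-edge⇔ _) (larger-used (ℕ.≤-reflexive (sym (toℕ-fromℕ< 1+letter<k)))))
      ... | no 1+letter≮k  = ℕ.≤-trans (ℕ.≮⇒≥ 1+letter≮k) (s≤s (ℕ.m≤m+n _ _))

    balanced-suc-current : Balanced (suc t) X
    balanced-suc-current = record
      { outdeg    = suc outdeg
      ; out-edge⇔ = λ d → mk⇔ (to d) (from d)
      ; balance   = trans (rebalance _ _ _ _ (balance-current (balanced X) refl)) (cong (_+ [ X ≟ zeros ]) (sym (indeg-∷ X new∉)))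
      }
      where
      to : ∀ d → X ∷ʳ d ∈ history (suc t) → k ℕ.≤ toℕ d + suc outdeg
      to d (here eq) rewrite ∷ʳ-injectiveʳ _ _ (trans eq w-suc≡) =
        ℕ.≤-reflexive (trans (sym greedy-outdeg) (sym (ℕ.+-suc _ _)))
      to d (there ∈) = ℕ.≤-trans (Equivalence.to (out-edge⇔ d) ∈) (ℕ.+-monoʳ-≤ (toℕ d) (ℕ.n≤1+n outdeg))
      from : ∀ d → k ℕ.≤ toℕ d + suc outdeg → X ∷ʳ d ∈ history (suc t)
      from d k≤ with k ℕ.≤? toℕ d + outdeg
      ... | yes k≤′ = there (Equivalence.from (out-edge⇔ d) k≤′)
      ... | no k≰   = here (trans (cong (X ∷ʳ_) d≡letter) (sym w-suc≡))
        where
        d≡letter : d ≡ letter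
        d≡letter = toℕ-injective (ℕ.+-cancelʳ-≡ outdeg _ _ (ℕ.suc-injective (trans
          (ℕ.≤-antisym (ℕ.≰⇒> k≰) (subst (k ℕ.≤_) (ℕ.+-suc _ _) k≤)) (sym greedy-outdeg))))

    balanced-suc-other : ∀ {y} → X ≢ y → Balanced (suc t) y
    balanced-suc-other {y} X≢y = record
      { outdeg    = outdeg′
      ; out-edge⇔ = λ d → mk⇔ (Equivalence.to (out-edge⇔′ d) ∘ drop-new d) (there ∘ Equivalence.from (out-edge⇔′ d))
      ; balance   = trans (rebalance _ _ _ _ (balance-other (balanced y) X≢y)) (cong (_+ [ y ≟ zeros ]) (sym (indeg-∷ y new∉)))
      }
      where
      open Balanced (balanced y) renaming (outdeg to outdeg′; out-edge⇔ to out-edge⇔′)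
      drop-new : ∀ d → y ∷ʳ d ∈ history (suc t) → y ∷ʳ d ∈ history t
      drop-new d (here eq) = contradiction (sym (∷ʳ-injectiveˡ _ _ (trans eq w-suc≡))) X≢y
      drop-new d (there ∈) = ∈

    balanced-suc : ∀ y → Balanced (suc t) y
    balanced-suc y with X ≟ y
    ... | yes refl = balanced-suc-current
    ... | no X≢y   = balanced-suc-other X≢y

    distinct-suc : Distinct (suc t)
    distinct-suc {a} {b} a≤ b≤ wa≡wb with ℕ.m≤n⇒m<n∨m≡n a≤ | ℕ.m≤n⇒m<n∨m≡n b≤
    ... | inj₁ (s≤s a≤t) | inj₁ (s≤s b≤t) = distinct a≤t b≤t wa≡wb
    ... | inj₂ refl      | inj₂ refl      = refl
    ... | inj₂ refl      | inj₁ (s≤s b≤t) = contradiction (subst (_∈ history t) (sym wa≡wb) (w∈history b≤t)) new∉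
    ... | inj₁ (s≤s a≤t) | inj₂ refl      = contradiction (subst (_∈ history t) wa≡wb (w∈history a≤t)) new∉

    invariant-suc : Invariant (suc t)
    invariant-suc = record { balanced = balanced-suc ; distinct = distinct-suc }

    -- x′ has been visited at least as often as X, hence left at least as often as X will
    -- have been after this step; its used letters form a top segment, so they reach letter.
    dominating-out-edge : ∀ {x′} → X ≢ zeros → X ≢ x′ →
                          (∀ {ρ} → ρ ∷ X ∈ history t → ρ ∷ x′ ∈ history t) → x′ ∷ʳ letter ∈ history t
    dominating-out-edge {x′} X≢zeros X≢x′ in-edges⊆ = Equivalence.from (out-edge⇔′ letter) (begin
      k                                   ≡⟨ greedy-outdeg ⟨
      suc (toℕ letter + outdeg)           ≡⟨ ℕ.+-suc _ _ ⟨
      toℕ letter + suc outdeg             ≡⟨ cong (toℕ letter +_) 1+outdeg≡indeg ⟩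
      toℕ letter + indeg (history t) X    ≤⟨ ℕ.+-monoʳ-≤ (toℕ letter) indeg≤indeg ⟩
      toℕ letter + indeg (history t) x′   ≤⟨ ℕ.+-monoʳ-≤ (toℕ letter) indeg≤outdeg′ ⟩
      toℕ letter + outdeg′                ∎)
      where
      open ℕ.≤-Reasoning
      open Balanced (balanced x′) renaming (outdeg to outdeg′; out-edge⇔ to out-edge⇔′)
      1+outdeg≡indeg : suc outdeg ≡ indeg (history t) X
      1+outdeg≡indeg = trans (balance-current (balanced X) refl)
                             (trans (cong (indeg (history t) X +_) ([no] (X ≟ zeros) X≢zeros)) (ℕ.+-identityʳ _))
      indeg≤indeg : indeg (history t) X ℕ.≤ indeg (history t) x′
      indeg≤indeg = count-mono (λ ρ → (ρ ∷ X) ∈? history t) (λ ρ → (ρ ∷ x′) ∈? history t) in-edges⊆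
      indeg≤outdeg′ : indeg (history t) x′ ℕ.≤ outdeg′
      indeg≤outdeg′ = ℕ.≤-trans (ℕ.m≤m+n _ _) (ℕ.≤-reflexive (sym (balance-other (balanced x′) X≢x′)))

  k≤indeg⇒∈ : ∀ {H y} → k ℕ.≤ indeg H y → ∀ ρ → ρ ∷ y ∈ H
  k≤indeg⇒∈ {H} {y} k≤indeg ρ with (ρ ∷ y) ∈? H
  ... | yes ρy∈H = ρy∈H
  ... | no ρy∉H  = contradiction k≤indeg (ℕ.<⇒≱ (count<n (λ ρ → (ρ ∷ y) ∈? H) ρy∉H))

  module Stuck⇒Complete {t} (balanced : ∀ x → Balanced t x) (stuck : Stuck t) where

    open Balanced

    X : Node
    X = tail (w t)

    k≤outdeg : ∀ {y} → y ∷ʳ zero ∈ history t → k ℕ.≤ outdeg (balanced y)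
    k≤outdeg {y} = Equivalence.to (out-edge⇔ (balanced y) zero)

    X≡zeros : X ≡ zeros
    X≡zeros with X ≟ zeros
    ... | yes X≡zeros = X≡zeros
    ... | no X≢zeros  = contradiction (k≤outdeg (stuck zero))
                          (ℕ.<⇒≱ (ℕ.≤-trans outdeg<indeg (count≤n (λ ρ → (ρ ∷ X) ∈? history t))))
      where
      outdeg<indeg : outdeg (balanced X) ℕ.< indeg (history t) X
      outdeg<indeg = ℕ.≤-reflexive (trans (balance-current (balanced X) refl)
                                          (trans (cong (indeg (history t) X +_) ([no] (X ≟ zeros) X≢zeros)) (ℕ.+-identityʳ _)))

    outdeg≡indeg : ∀ y → outdeg (balanced y) ≡ indeg (history t) y
    outdeg≡indeg y = ℕ.+-cancelʳ-≡ _ _ _ (trans (cong (outdeg (balanced y) +_) same-bracket) (balance (balanced y)))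
      where
      same-bracket : [ y ≟ zeros ] ≡ [ X ≟ y ]
      same-bracket with y ≟ zeros
      ... | yes y≡zeros = sym ([yes] (X ≟ y) (trans X≡zeros (sym y≡zeros)))
      ... | no y≢zeros  = sym ([no] (X ≟ y) (λ X≡y → y≢zeros (trans (sym X≡y) X≡zeros)))

    in-edges-used : ∀ {y} → y ∷ʳ zero ∈ history t → ∀ ρ → ρ ∷ y ∈ history t
    in-edges-used {y} y0∈ = k≤indeg⇒∈ (subst (k ℕ.≤_) (outdeg≡indeg y) (k≤outdeg y0∈))

    -- Shifting in zeros from the right reaches 0ⁿ after n steps, and in-edges-used
    -- pulls membership back along each shift.
    zero-tail-used : ∀ c (v : Word) → ConstantFrom c zero v → v ∈ history t
    zero-tail-used zero    v       const rewrite ConstantFrom-zero v const =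
      in-edges-used (subst (λ x → x ∷ʳ zero ∈ history t) X≡zeros (stuck zero)) zero
    zero-tail-used (suc c) (ρ ∷ y) const =
      in-edges-used (zero-tail-used c (y ∷ʳ zero) (ConstantFrom-shift ρ y const)) ρ

    complete : ∀ v → v ∈ history t
    complete v = zero-tail-used n v (ConstantFrom-length zero v)

  distinct⇒<N : ∀ {t} → Distinct t → t ℕ.< N
  distinct⇒<N {t} distinct = F.injective⇒≤ {f = code ∘ w ∘ toℕ} injective
    where
    open Injection (↔⇒↣ (Vec↔Fin^ k n)) using () renaming (to to code; injective to code-injective)
    injective : ∀ {a b : Fin (suc t)} → code (w (toℕ a)) ≡ code (w (toℕ b)) → a ≡ b
    injective {a} {b} eq = toℕ-injective (distinct (ℕ.≤-pred (toℕ<n a)) (ℕ.≤-pred (toℕ<n b)) (code-injective eq))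

  complete⇒N≤ : ∀ {t} → (∀ v → v ∈ history t) → N ℕ.≤ suc t
  complete⇒N≤ {t} complete = F.injective⇒≤ {f = time} injective
    where
    open Injection (↔⇒↣ (↔-sym (Vec↔Fin^ k n))) using () renaming (to to word; injective to word-injective)
    seen : ∀ i → Before (suc t) (word i)
    seen i = ∈history⁻ t (complete (word i))
    time : Fin N → Fin (suc t)
    time i = fromℕ< (proj₁ (proj₂ (seen i)))
    injective : ∀ {a b} → time a ≡ time b → a ≡ b
    injective {a} {b} eq = word-injective (begin
      word a              ≡⟨ proj₂ (proj₂ (seen a)) ⟨
      w (proj₁ (seen a))  ≡⟨ cong w (trans (sym (toℕ-fromℕ< _)) (trans (cong toℕ eq) (toℕ-fromℕ< _))) ⟩
      w (proj₁ (seen b))  ≡⟨ proj₂ (proj₂ (seen b)) ⟩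
      word b              ∎)
      where open ≡-Reasoning

  stuck⇒N≤ : ∀ {t} → Invariant t → Stuck t → N ℕ.≤ suc t
  stuck⇒N≤ inv stuck = complete⇒N≤ (Stuck⇒Complete.complete (Invariant.balanced inv) stuck)

  invariant : ∀ {t} → t ℕ.< N → Invariant t
  invariant {zero}  _      = invariant-zero
  invariant {suc t} 1+t<N with stuck-or-greedy t
  ... | inj₁ stuck = contradiction (stuck⇒N≤ (invariant (ℕ.<-trans (ℕ.n<1+n t) 1+t<N)) stuck) (ℕ.<⇒≱ 1+t<N)
  ... | inj₂ step  = Step.invariant-suc (invariant (ℕ.<-trans (ℕ.n<1+n t) 1+t<N)) step

  greedy : ∀ {t} → suc t ℕ.< N → GreedyStep t
  greedy {t} 1+t<N with stuck-or-greedy t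
  ... | inj₁ stuck = contradiction (stuck⇒N≤ (invariant (ℕ.<-trans (ℕ.n<1+n t) 1+t<N)) stuck) (ℕ.<⇒≱ 1+t<N)
  ... | inj₂ step  = step

  ¬stuck : ∀ {t} → suc t ℕ.< N → ¬ Stuck t
  ¬stuck 1+t<N stuck = fresh (stuck letter)
    where open GreedyStep (greedy 1+t<N)

  T : ℕ
  T = N ∸ 1

  1+T≡N : suc T ≡ N
  1+T≡N = ℕ.m+[n∸m]≡n (ℕ.m^n>0 k n)

  T<N : T ℕ.< N
  T<N = ℕ.≤-reflexive 1+T≡N

  <N⇒≤T : ∀ {i} → i ℕ.< N → i ℕ.≤ T
  <N⇒≤T {i} i<N = ℕ.≤-pred (subst (i ℕ.<_) (sym 1+T≡N) i<N)

  w-injective : ∀ {a b} → a ℕ.< N → b ℕ.< N → w a ≡ w b → a ≡ b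
  w-injective a<N b<N = Invariant.distinct (invariant T<N) (<N⇒≤T a<N) (<N⇒≤T b<N)

  stuck-at-T : Stuck T
  stuck-at-T with stuck-or-greedy T
  ... | inj₁ stuck = stuck
  ... | inj₂ step  = contradiction (distinct⇒<N (Step.distinct-suc (invariant T<N) step))
                                  (ℕ.<-irrefl refl ∘ subst (suc T ℕ.<_) (sym 1+T≡N))

  w-surjective : ∀ v → Before N v
  w-surjective v = subst (λ M → Before M v) 1+T≡N
                         (∈history⁻ T (Stuck⇒Complete.complete (Invariant.balanced (invariant T<N)) stuck-at-T v))

  -- If 0ⁿ appeared before step T, the walk would already be stuck there.
  w-last : w T ≡ zero ∷ zeros
  w-last with w-surjective (zero ∷ zeros)
  ... | i , i<N , wi≡0 with ℕ.m≤n⇒m<n∨m≡n (<N⇒≤T i<N)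
  ...   | inj₂ refl = wi≡0
  ...   | inj₁ i<T  = contradiction wi≡0 (not-before-T i i<T)
    where
    zeros∷ʳ0 : zeros ∷ʳ zero ≡ zero ∷ zeros
    zeros∷ʳ0 = replicate-∷ʳ m zero
    not-before-T : ∀ i → i ℕ.< T → w i ≢ zero ∷ zeros
    not-before-T zero    _     w₀≡0   = contradiction (∷ʳ-injectiveʳ zeros zeros (trans w₀≡0 (sym zeros∷ʳ0))) λ ()
    not-before-T (suc s) 1+s<T w1+s≡0 = ¬stuck (ℕ.≤-<-trans 1+s<T T<N) stuck
      where
      open GreedyStep (greedy (ℕ.<-trans 1+s<T T<N))
      prefix≡ : tail (w s) ≡ zeros × letter ≡ zero
      prefix≡ = ∷ʳ-injective _ _ (trans (sym w-suc≡) (trans w1+s≡0 (sym zeros∷ʳ0)))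
      used : ∀ τ → zeros ∷ʳ τ ∈ history (suc s)
      used zero    = here (trans zeros∷ʳ0 (sym w1+s≡0))
      used (suc τ) = there (subst (λ x → x ∷ʳ suc τ ∈ history s) (proj₁ prefix≡)
                                  (larger-used (subst (F._< suc τ) (sym (proj₂ prefix≡)) (s≤s z≤n))))
      stuck : Stuck (suc s)
      stuck τ = subst (λ x → x ∷ʳ τ ∈ history (suc s)) (sym (cong tail w1+s≡0)) (used τ)

  -- Predecessors in the cycle

  prev<N : ∀ {i} → i ℕ.< N → prev i ℕ.< N
  prev<N {zero}  _     = T<N
  prev<N {suc i} 1+i<N = ℕ.<-trans (ℕ.n<1+n i) 1+i<N

  prev-injective : ∀ {a b} → a ℕ.< N → b ℕ.< N → prev a ≡ prev b → a ≡ b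
  prev-injective {zero}  {zero}  _     _     _  = refl
  prev-injective {zero}  {suc b} _     1+b<N eq = contradiction (subst (ℕ._< N) (cong suc (sym eq)) 1+b<N) (ℕ.<-irrefl 1+T≡N)
  prev-injective {suc a} {zero}  1+a<N _     eq = contradiction (subst (ℕ._< N) (cong suc eq) 1+a<N) (ℕ.<-irrefl 1+T≡N)
  prev-injective {suc a} {suc b} _     _     eq = cong suc eq

  prev-surjective : ∀ {t} → t ℕ.< N → ∃ λ i → i ℕ.< N × prev i ≡ t
  prev-surjective t<N with ℕ.m≤n⇒m<n∨m≡n (<N⇒≤T t<N)
  ... | inj₁ t<T  = _ , ℕ.≤-<-trans t<T T<N , refl
  ... | inj₂ refl = 0 , ℕ.m^n>0 k n , refl

  prev-mono-< : ∀ {a b} → a ≢ 0 → a ℕ.< b → prev a ℕ.< prev b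
  prev-mono-< {zero}          a≢0 _       = contradiction refl a≢0
  prev-mono-< {suc a} {suc b} _   1+a<1+b = ℕ.≤-pred 1+a<1+b

  w-overlap : ∀ {i} → i ℕ.< N → ∃ λ d → w i ≡ tail (w (prev i)) ∷ʳ d
  w-overlap {zero}  _     = top , cong (λ v → tail v ∷ʳ top) (sym w-last)
  w-overlap {suc i} 1+i<N = letter , w-suc≡
    where open GreedyStep (greedy 1+i<N)

  position : Word → ℕ
  position v = proj₁ (w-surjective v)

  position<N : ∀ v → position v ℕ.< N
  position<N v = proj₁ (proj₂ (w-surjective v))

  w∘position : ∀ v → w (position v) ≡ v
  w∘position v = proj₂ (proj₂ (w-surjective v))

  position-unique : ∀ {i v} → i ℕ.< N → w i ≡ v → i ≡ position v
  position-unique {v = v} i<N wi≡v = w-injective i<N (position<N v) (trans wi≡v (sym (w∘position v)))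

  entry : Node → Fin k → Fin k
  entry x d = head (w (prev (position (x ∷ʳ d))))

  w∘prev : ∀ {i x d} → i ℕ.< N → w i ≡ x ∷ʳ d → w (prev i) ≡ entry x d ∷ x
  w∘prev {i} {x} {d} i<N wi≡xd = begin
    w (prev i)                              ≡⟨ head∷tail (w (prev i)) ⟩
    head (w (prev i)) ∷ tail (w (prev i))   ≡⟨ cong₂ _∷_ (cong (head ∘ w ∘ prev) (position-unique i<N wi≡xd)) tail≡x ⟩
    entry x d ∷ x                           ∎
    where
    open ≡-Reasoning
    head∷tail : ∀ (v : Word) → v ≡ head v ∷ tail v
    head∷tail (_ ∷ _) = refl
    tail≡x : tail (w (prev i)) ≡ x
    tail≡x = ∷ʳ-injectiveˡ _ _ (trans (sym (proj₂ (w-overlap i<N))) wi≡xd)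

  w∘prev∘position : ∀ x d → w (prev (position (x ∷ʳ d))) ≡ entry x d ∷ x
  w∘prev∘position x d = w∘prev (position<N _) (w∘position _)

  entry-injective : ∀ x {a b} → entry x a ≡ entry x b → a ≡ b
  entry-injective x {a} {b} eq = ∷ʳ-injectiveʳ x x (begin
    x ∷ʳ a                 ≡⟨ w∘position (x ∷ʳ a) ⟨
    w (position (x ∷ʳ a))  ≡⟨ cong w (prev-injective (position<N _) (position<N _) same-prev) ⟩
    w (position (x ∷ʳ b))  ≡⟨ w∘position (x ∷ʳ b) ⟩
    x ∷ʳ b                 ∎)
    where
    open ≡-Reasoning
    same-prev : prev (position (x ∷ʳ a)) ≡ prev (position (x ∷ʳ b))
    same-prev = w-injective (prev<N (position<N _)) (prev<N (position<N _))
      (trans (w∘prev∘position x a) (trans (cong (_∷ x) eq) (sym (w∘prev∘position x b))))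

  entry-surjective : ∀ x ρ → ∃ λ d → entry x d ≡ ρ
  entry-surjective x ρ with prev-surjective (position<N (ρ ∷ x))
  ... | i , i<N , prev-i≡t with w-overlap i<N
  ...   | d , wi≡ = d , ∷-injectiveˡ (trans (sym (w∘prev i<N wi≡xd)) w-prev-i≡ρx)
    where
    w-prev-i≡ρx : w (prev i) ≡ ρ ∷ x
    w-prev-i≡ρx = trans (cong w prev-i≡t) (w∘position (ρ ∷ x))
    wi≡xd : w i ≡ x ∷ʳ d
    wi≡xd = trans wi≡ (cong (λ v → tail v ∷ʳ d) w-prev-i≡ρx)

  larger-letter-first : ∀ {a b x d d′} → a ℕ.< N → b ℕ.< N →
                        w a ≡ x ∷ʳ d → w b ≡ x ∷ʳ d′ → d′ F.< d → a ℕ.< b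
  larger-letter-first {b = zero} {d = d} _ _ _ w₀≡xd′ d′<d =
    contradiction (subst (F._< d) (sym (∷ʳ-injectiveʳ _ _ w₀≡xd′)) d′<d)
                  (ℕ.≤⇒≯ (subst (toℕ d ℕ.≤_) (sym toℕ-top) (ℕ.≤-pred (toℕ<n d))))
  larger-letter-first {a} {suc s} {x} {d} a<N 1+s<N wa≡xd w1+s≡xd′ d′<d = subst (ℕ._< suc s) s′≡a s′<1+s
    where
    open GreedyStep (greedy 1+s<N)
    prefix≡ : tail (w s) ≡ x × letter ≡ _
    prefix≡ = ∷ʳ-injective _ _ (trans (sym w-suc≡) w1+s≡xd′)
    seen : Before (suc s) (tail (w s) ∷ʳ d)
    seen = ∈history⁻ s (larger-used (subst (F._< d) (sym (proj₂ prefix≡)) d′<d))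
    s′ : ℕ
    s′ = proj₁ seen
    s′<1+s : s′ ℕ.< suc s
    s′<1+s = proj₁ (proj₂ seen)
    s′≡a : s′ ≡ a
    s′≡a = w-injective (ℕ.<-trans s′<1+s 1+s<N) a<N
             (trans (proj₂ (proj₂ seen)) (trans (cong (_∷ʳ d) (proj₁ prefix≡)) (sym wa≡xd)))

  raised-earlier : ∀ {t v} → t ℕ.< N → Raised (w t) v → Before t v
  raised-earlier {t} = <-rec (λ t → ∀ {v} → t ℕ.< N → Raised (w t) v → Before t v) step t
    where
    step : ∀ t → (∀ {s} → s ℕ.< t → ∀ {v} → s ℕ.< N → Raised (w s) v → Before s v) →
           ∀ {v} → t ℕ.< N → Raised (w t) v → Before t v
    step zero _ _ raised with Raised-∷ʳ zeros top raised
    ... | inj₁ (_ , _ , raised′) = contradiction refl (Raised⇒≢replicate raised′)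
    ... | inj₂ (c′ , _ , top<c′) =
      contradiction (subst (ℕ._< toℕ c′) toℕ-top top<c′) (ℕ.≤⇒≯ (ℕ.≤-pred (toℕ<n c′)))
    step (suc s) earlier {v} 1+s<N raised =
      extend (Raised-∷ʳ (tail (w s)) letter (subst (λ u → Raised u v) w-suc≡ raised))
      where
      open GreedyStep (greedy 1+s<N)
      s<N : s ℕ.< N
      s<N = ℕ.<-trans (ℕ.n<1+n s) 1+s<N
      extend : (∃ λ x′ → v ≡ x′ ∷ʳ letter × Raised (tail (w s)) x′) ⊎
               (∃ λ c′ → v ≡ tail (w s) ∷ʳ c′ × letter F.< c′) → Before (suc s) v
      extend (inj₂ (c′ , refl , letter<c′)) = ∈history⁻ s (larger-used letter<c′)
      extend (inj₁ (x′ , refl , raised′))   = ∈history⁻ s (Step.dominating-out-edge (invariant s<N) (greedy 1+s<N)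
                                                (Raised⇒≢replicate raised′) (Raised⇒≢ raised′) in-edges⊆)
        where
        in-edges⊆ : ∀ {ρ} → ρ ∷ tail (w s) ∈ history s → ρ ∷ x′ ∈ history s
        in-edges⊆ {ρ} ρX∈ with ∈history⁻ s ρX∈
        ... | s″ , s″<1+s , ws″≡ρX with earlier s″<1+s (ℕ.<-trans s″<1+s 1+s<N)
                                        (subst (λ u → Raised u (ρ ∷ x′)) (sym ws″≡ρX) (there raised′))
        ...   | s‴ , s‴<s″ , ws‴≡ρx′ =
          subst (_∈ history s) ws‴≡ρx′ (w∈history (ℕ.≤-pred (ℕ.<-trans s‴<s″ s″<1+s)))

  entry-mono : ∀ x {d d′} → d F.< d′ → entry x d′ ≢ zero → entry x d F.< entry x d′
  entry-mono x {d} {d′} d<d′ entry≢0 = ≤∧≢⇒< (ℕ.≮⇒≥ not-above) (<⇒≢ d<d′ ∘ entry-injective x)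
    where
    a b : ℕ
    a = position (x ∷ʳ d′)
    b = position (x ∷ʳ d)
    a≢0 : a ≢ 0
    a≢0 a≡0 = entry≢0 (∷-injectiveˡ (trans (sym (w∘prev∘position x d′)) (trans (cong (w ∘ prev) a≡0) w-last)))
    prev-a<prev-b : prev a ℕ.< prev b
    prev-a<prev-b = prev-mono-< a≢0 (larger-letter-first (position<N _) (position<N _) (w∘position _) (w∘position _) d<d′)
    not-above : ¬ (entry x d′ F.< entry x d)
    not-above entry-d′<entry-d with raised-earlier (prev<N (position<N _))
      (subst₂ Raised (sym (w∘prev∘position x d′)) (sym (w∘prev∘position x d))
              (here (ℕ.n≢0⇒n>0 (entry≢0 ∘ toℕ-injective)) entry-d′<entry-d))
    ... | s , s<prev-a , ws≡ = ℕ.<-asym prev-a<prev-b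
      (subst (ℕ._< prev a) (w-injective (ℕ.<-trans s<prev-a (prev<N (position<N _))) (prev<N (position<N _)) ws≡) s<prev-a)

  ¬B*[x∷ʳtop] : ∀ x → ¬ B* (x ∷ʳ top)
  ¬B*[x∷ʳtop] x (_ , _ , wi≡ , x′ , σ′ , τ′ , wi≡x′σ′ , _ , τ′≡1+σ′)
    with ∷ʳ-injective x′ x (trans (sym wi≡x′σ′) wi≡)
  ... | refl , refl = ℕ.<-irrefl (trans τ′≡1+σ′ (cong suc toℕ-top)) (toℕ<n τ′)

  B*⇔ : ∀ x σ → B* (x ∷ʳ σ) ⇔ toℕ (entry x σ) ≡ suc (toℕ σ)
  B*⇔ x σ = mk⇔ to from
    where
    to : B* (x ∷ʳ σ) → toℕ (entry x σ) ≡ suc (toℕ σ)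
    to (i , i<N , wi≡ , x′ , σ′ , τ′ , wi≡x′σ′ , w-prev-i≡ , τ′≡1+σ′)
      with ∷ʳ-injective x′ x (trans (sym wi≡x′σ′) wi≡)
    ... | refl , refl = trans (cong toℕ (∷-injectiveˡ (trans (sym (w∘prev i<N wi≡)) w-prev-i≡))) τ′≡1+σ′
    from : toℕ (entry x σ) ≡ suc (toℕ σ) → B* (x ∷ʳ σ)
    from eq = position (x ∷ʳ σ) , position<N _ , w∘position _ ,
              x , σ , entry x σ , w∘position _ , w∘prev∘position x σ , eq

  A*⇔ : ∀ x τ → τ ≢ zero → A* (x ∷ʳ τ) ⇔ (entry x τ ≡ zero ⊎ toℕ (entry x τ) ≡ suc (toℕ τ))
  A*⇔ x τ τ≢0 = mk⇔ to from
    where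
    to : A* (x ∷ʳ τ) → entry x τ ≡ zero ⊎ toℕ (entry x τ) ≡ suc (toℕ τ)
    to (i , i<N , wi≡ , x′ , τ′ , wi≡x′τ′ , _ , after-0x-or-B)
      with ∷ʳ-injective x′ x (trans (sym wi≡x′τ′) wi≡)
    ... | refl , refl with after-0x-or-B
    ...   | inj₁ w-prev-i≡0x = inj₁ (∷-injectiveˡ (trans (sym (w∘prev i<N wi≡)) w-prev-i≡0x))
    ...   | inj₂ B-at-i      = inj₂ (Equivalence.to (B*⇔ x τ) (i , i<N , wi≡ , B-at-i))
    from : entry x τ ≡ zero ⊎ toℕ (entry x τ) ≡ suc (toℕ τ) → A* (x ∷ʳ τ)
    from hit = position (x ∷ʳ τ) , position<N _ , w∘position _ , x , τ , w∘position _ , τ≢0 , after hit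
      where
      after : entry x τ ≡ zero ⊎ toℕ (entry x τ) ≡ suc (toℕ τ) →
              (w (prev (position (x ∷ʳ τ))) ≡ zero ∷ x) ⊎ B-at (position (x ∷ʳ τ))
      after (inj₁ entry≡0)   = inj₁ (trans (w∘prev∘position x τ) (cong (_∷ x) entry≡0))
      after (inj₂ entry≡1+τ) = inj₂ (x , τ , entry x τ , w∘position _ , w∘prev∘position x τ , entry≡1+τ)

proposition13 : (j m : ℕ) → let open PreferMax (suc j) m in
    (x : Vec (Fin k) m) →
      (¬ B* (x ∷ʳ top)) ×
      ((σ τ : Fin k) → toℕ τ ≡ suc (toℕ σ) → B* (x ∷ʳ σ) ⇔ A* (x ∷ʳ τ))
proposition13 j m x = ¬B*[x∷ʳtop] x , B*[xσ]⇔A*[xτ]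
  where
  open PreferMaxCycle j m
  open IncreasingOffZero (entry x) (entry-injective x) (entry-mono x) (proj₂ (entry-surjective x zero))
  B*[xσ]⇔A*[xτ] : ∀ σ τ → toℕ τ ≡ suc (toℕ σ) → B* (x ∷ʳ σ) ⇔ A* (x ∷ʳ τ)
  B*[xσ]⇔A*[xτ] σ τ τ≡1+σ = begin
    B* (x ∷ʳ σ)                                          ∼⟨ B*⇔ x σ ⟩
    toℕ (entry x σ) ≡ suc (toℕ σ)                        ∼⟨ p[σ]≡1+σ⇔p[τ]≡0⊎1+τ τ≡1+σ ⟩
    (entry x τ ≡ zero ⊎ toℕ (entry x τ) ≡ suc (toℕ τ))  ∼⟨ SK-sym (A*⇔ x τ τ≢0) ⟩
    A* (x ∷ʳ τ)                                          ∎
    where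
    open EquationalReasoning
    τ≢0 : τ ≢ zero
    τ≢0 τ≡0 = ℕ.0≢1+n (trans (sym (cong toℕ τ≡0)) τ≡1+σ)
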